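{- Let $\ell,n\geq 1$ be positive integers with $\ell\nmid n$. Then for any positive integer $t$ with $t\mid n$, $$\sum_{\substack{k\mid \ell\\ \gcd(k,n)=t}}\mu\Big(\frac{\ell}{k}\Big)=0,$$ where $\mu$ is the Möbius function. -}

module Defs where

open import Data.Nat using (ℕ; zero; suc; _*_; _≤_; _<_)
open import Data.Nat.Divisibility using (_∣_; _∣?_)
open import Data.Nat.DivMod using (_/_)
open import Data.Nat.Primality using (Prime; prime?)
open import Data.Nat.GCD using (gcd)
open import Data.Integer using (ℤ; +_; -_; _^_) renaming (_+_ to _+ℤ_)
open import Data.List using (List; filter; upTo; length; map; foldr; drop)
open import Data.Bool using (if_then_else_)
open import Data.Product using (_×_)
open import Relation.Nullary using (¬_; does)
open import Relation.Nullary.Decidable using (_×-dec_; ¬?)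
open import Relation.Binary.PropositionalEquality using (_≡_)
import Data.Nat as ℕ

range1 : ℕ → List ℕ
range1 n = drop 1 (upTo (suc n))

primeDivisors : ℕ → List ℕ
primeDivisors n = filter (λ p → prime? p ×-dec (p ∣? n)) (range1 n)

-- primes p ≤ n with p² ∣ n; n (≥ 1) is squarefree iff this list is empty
squareFactors : ℕ → List ℕ
squareFactors n = filter (λ p → (p * p) ∣? n) (primeDivisors n)

-- Möbius function μ : ℕ → ℤ (value at 0 is irrelevant, set to 0 by convention here:
-- 0 is divisible by 2², so the formula below gives 0)
μ : ℕ → ℤ
μ n with squareFactors n
... | List.[] = (- (+ 1)) ^ length (primeDivisors n)
... | _ List.∷ _ = + 0

sumℤ : List ℤ → ℤ
sumℤ = foldr _+ℤ_ (+ 0)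

_÷_ : ℕ → ℕ → ℕ
m ÷ zero = 0
m ÷ suc k = m / suc k

-- Σ_{k ∣ ℓ, gcd(k,n) = t} μ(ℓ/k)   (for ℓ ≥ 1 all divisors lie in 1..ℓ)
mobiusGcdSum : ℕ → ℕ → ℕ → ℤ
mobiusGcdSum ℓ n t =
  sumℤ (map (λ k → μ (ℓ ÷ k))
            (filter (λ k → (k ∣? ℓ) ×-dec (gcd k n ℕ.≟ t)) (range1 ℓ)))

{-# OPTIONS --safe #-}

-- Since ℓ ∤ n, some prime power p^(a+1) divides ℓ but not n; write ℓ = p M, so p^a ∣ M.
-- Split the terms according to whether p divides the cofactor ℓ/k: if p ∤ ℓ/k then p ∣ k,
-- and if p ∣ ℓ/k then k ∣ M, so the terms pair up as k = p j against k = j with j ∣ M.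
-- With e = M/j the two cofactors are e and p e. If p ∣ e, both terms vanish (the first is
-- excluded and μ(p e) = 0). Otherwise μ(p e) = −μ(e), and p^a ∣ j together with p^(a+1) ∤ n
-- gives gcd(p j, n) = gcd(j, n), so the two terms are admitted together and cancel.

module Submission where

open import Defs
open import Data.Bool using (true; false; if_then_else_)
open import Data.Empty using (⊥-elim)
open import Data.Integer as ℤ using (ℤ; +_; -_; 0ℤ; 1ℤ; -1ℤ; _+_)
import Data.Integer.Properties as ℤₚ
open import Data.List using (List; []; _∷_; _++_; [_]; map; filter; length)
open import Data.List.Membership.Propositional using (_∈_)
open import Data.List.Membership.Propositional.Properties using (∈-applyUpTo⁺; ∈-filter⁺; ∈-filter⁻)
import Data.List.Properties as Listₚ
open import Data.List.Relation.Unary.All using (All; []; _∷_)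
open import Data.List.Relation.Unary.Any using (here)
open import Data.Nat as ℕ using (ℕ; zero; suc; _≤_; _<_; _≤′_; ≤′-refl; ≤′-step; s≤s; _*_; _^_; _≟_; NonZero)
import Data.Nat.Properties as ℕₚ
open import Data.Nat.Coprimality using (Coprime; coprime-divisor)
open import Data.Nat.Divisibility
open import Data.Nat.DivMod using (m*n/n≡m; m/n*n≡m)
open import Data.Nat.GCD using (gcd; gcd[m,n]∣m; gcd[m,n]∣n; gcd-greatest; c*gcd[m,n]≡gcd[cm,cn])
open import Data.Nat.ListAction using (product)
open import Data.Nat.Primality
open import Data.Nat.Primality.Factorisation using (PrimeFactorisation; factorise)
open import Data.Product using (_×_; _,_; ∃₂)
open import Data.Sum as Sum using (_⊎_; inj₁; inj₂)
open import Function using (_∘_)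
open import Relation.Binary.PropositionalEquality
  using (_≡_; refl; sym; trans; cong; cong₂; subst; subst₂; module ≡-Reasoning)
open import Relation.Nullary using (¬_; Dec; yes; no; does)
open import Relation.Nullary.Decidable using (_×-dec_; ¬?)
open import Relation.Unary using (Pred; Decidable)

open import Algebra.Properties.CommutativeSemigroup ℤₚ.+-commutativeSemigroup using (interchange)
import Algebra.Properties.CommutativeSemigroup ℕₚ.*-commutativeSemigroup as ℕ*

open ≡-Reasoning

-- Guarded values and sums over 1, …, n

guard : ∀ {p} {P : Set p} → Dec P → ℤ → ℤ
guard P? z = if does P? then z else 0ℤ

guard-yes : ∀ {p} {P : Set p} (P? : Dec P) {z} → P → guard P? z ≡ z
guard-yes (yes _) _  = refl
guard-yes (no ¬p) p = ⊥-elim (¬p p)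

guard-no : ∀ {p} {P : Set p} (P? : Dec P) {z} → ¬ P → guard P? z ≡ 0ℤ
guard-no (yes p) ¬p = ⊥-elim (¬p p)
guard-no (no _)  _  = refl

guard-0 : ∀ {p} {P : Set p} (P? : Dec P) → guard P? 0ℤ ≡ 0ℤ
guard-0 (yes _) = refl
guard-0 (no _)  = refl

guard²-no : ∀ {p q} {P : Set p} {Q : Set q} (P? : Dec P) (Q? : Dec Q) {z} → (P → ¬ Q) →
            guard P? (guard Q? z) ≡ 0ℤ
guard²-no (yes p) Q? P⇒¬Q = guard-no Q? (P⇒¬Q p)
guard²-no (no _)  _  _    = refl

guard-split : ∀ {p} {P : Set p} (P? : Dec P) z → z ≡ guard (¬? P?) z + guard P? z
guard-split (yes _) z = sym (ℤₚ.+-identityˡ z)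
guard-split (no _)  z = sym (ℤₚ.+-identityʳ z)

guard-cancel : ∀ {p q} {P : Set p} {Q : Set q} (P? : Dec P) (Q? : Dec Q) z → (P → Q) → (Q → P) →
               guard P? z + guard Q? (- z) ≡ 0ℤ
guard-cancel (yes _) (yes _) z _   _   = ℤₚ.+-inverseʳ z
guard-cancel (yes p) (no ¬q) z P⇒Q _   = ⊥-elim (¬q (P⇒Q p))
guard-cancel (no ¬p) (yes q) z _   Q⇒P = ⊥-elim (¬p (Q⇒P q))
guard-cancel (no _)  (no _)  z _   _   = refl

sum₁ : ℕ → (ℕ → ℤ) → ℤ
sum₁ zero    f = 0ℤ
sum₁ (suc n) f = sum₁ n f + f (suc n)

sum₁-cong : ∀ n {f g} → (∀ {i} → 1 ≤ i → i ≤ n → f i ≡ g i) → sum₁ n f ≡ sum₁ n g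
sum₁-cong zero    f≗g = refl
sum₁-cong (suc n) f≗g =
  cong₂ _+_ (sum₁-cong n (λ 1≤i i≤n → f≗g 1≤i (ℕₚ.m≤n⇒m≤1+n i≤n)))
            (f≗g (s≤s ℕ.z≤n) ℕₚ.≤-refl)

sum₁-zero : ∀ n {f} → (∀ {i} → 1 ≤ i → i ≤ n → f i ≡ 0ℤ) → sum₁ n f ≡ 0ℤ
sum₁-zero zero    f≗0 = refl
sum₁-zero (suc n) f≗0 =
  cong₂ _+_ (sum₁-zero n (λ 1≤i i≤n → f≗0 1≤i (ℕₚ.m≤n⇒m≤1+n i≤n)))
            (f≗0 (s≤s ℕ.z≤n) ℕₚ.≤-refl)

sum₁-distrib : ∀ n f g → sum₁ n (λ i → f i + g i) ≡ sum₁ n f + sum₁ n g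
sum₁-distrib zero    f g = refl
sum₁-distrib (suc n) f g = begin
  sum₁ n (λ i → f i + g i) + (f (suc n) + g (suc n))
    ≡⟨ cong (_+ (f (suc n) + g (suc n))) (sum₁-distrib n f g) ⟩
  (sum₁ n f + sum₁ n g) + (f (suc n) + g (suc n))
    ≡⟨ interchange (sum₁ n f) (sum₁ n g) (f (suc n)) (g (suc n)) ⟩
  (sum₁ n f + f (suc n)) + (sum₁ n g + g (suc n))
    ∎

sum₁-extend : ∀ {m n} f → m ≤ n → (∀ {i} → m < i → i ≤ n → f i ≡ 0ℤ) → sum₁ n f ≡ sum₁ m f
sum₁-extend {m} f m≤n = go (ℕₚ.≤⇒≤′ m≤n)
  where
  go : ∀ {n} → m ≤′ n → (∀ {i} → m < i → i ≤ n → f i ≡ 0ℤ) → sum₁ n f ≡ sum₁ m f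
  go ≤′-refl             _   = refl
  go (≤′-step {n} m≤′n) f≗0 = begin
    sum₁ n f + f (suc n)  ≡⟨ cong₂ _+_ (go m≤′n (λ m<i i≤n → f≗0 m<i (ℕₚ.m≤n⇒m≤1+n i≤n)))
                                       (f≗0 (s≤s (ℕₚ.≤′⇒≤ m≤′n)) ℕₚ.≤-refl) ⟩
    sum₁ m f + 0ℤ         ≡⟨ ℤₚ.+-identityʳ _ ⟩
    sum₁ m f              ∎

p*M<i<p*[1+M]⇒p∤i : ∀ p M {i} → p * M < i → i < p * suc M → ¬ p ∣ i
p*M<i<p*[1+M]⇒p∤i p M pM<i i<p[1+M] (divides-refl c) = ℕₚ.<⇒≱ M<c (ℕₚ.m<1+n⇒m≤n c<1+M)
  where
  M<c : M < c
  M<c = ℕₚ.*-cancelˡ-< p M c (subst (p * M <_) (ℕₚ.*-comm c p) pM<i)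
  c<1+M : c < suc M
  c<1+M = ℕₚ.*-cancelˡ-< p c (suc M) (subst (_< p * suc M) (ℕₚ.*-comm c p) i<p[1+M])

sum₁-multiples : ∀ p M {f} .{{_ : NonZero p}} → (∀ {i} → ¬ p ∣ i → f i ≡ 0ℤ) →
                 sum₁ (p * M) f ≡ sum₁ M (λ j → f (p * j))
sum₁-multiples p         zero    {f} f≗0 = cong (λ k → sum₁ k f) (ℕₚ.*-zeroʳ p)
sum₁-multiples p@(suc q) (suc M) {f} f≗0 = begin
  sum₁ (p * suc M) f                           ≡⟨ cong (λ k → sum₁ k f) (ℕₚ.*-suc p M) ⟩
  sum₁ (q ℕ.+ p * M) f + f (suc (q ℕ.+ p * M))  ≡⟨ cong₂ _+_ (sum₁-extend f (ℕₚ.m≤n+m _ q) between)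
                                                            (cong f (sym (ℕₚ.*-suc p M))) ⟩
  sum₁ (p * M) f + f (p * suc M)               ≡⟨ cong (_+ f (p * suc M)) (sum₁-multiples p M f≗0) ⟩
  sum₁ M (λ j → f (p * j)) + f (p * suc M)     ∎
  where
  between : ∀ {i} → p * M < i → i ≤ q ℕ.+ p * M → f i ≡ 0ℤ
  between {i} pM<i i≤q+pM = f≗0 (p*M<i<p*[1+M]⇒p∤i p M pM<i (subst (i <_) (sym (ℕₚ.*-suc p M)) (s≤s i≤q+pM)))

sum₁-pairing : ∀ p M {g h} .{{_ : NonZero p}} →
               (∀ {i} → ¬ p ∣ i → g i ≡ 0ℤ) → (∀ {i} → M < i → h i ≡ 0ℤ) →
               (∀ {j} → 1 ≤ j → j ≤ M → g (p * j) + h j ≡ 0ℤ) →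
               sum₁ (p * M) (λ i → g i + h i) ≡ 0ℤ
sum₁-pairing p M {g} {h} g≗0 h≗0 gh≗0 = begin
  sum₁ (p * M) (λ i → g i + h i)    ≡⟨ sum₁-distrib (p * M) g h ⟩
  sum₁ (p * M) g + sum₁ (p * M) h   ≡⟨ cong₂ _+_ (sum₁-multiples p M g≗0)
                                                 (sum₁-extend h (ℕₚ.m≤n*m M p) (λ M<i _ → h≗0 M<i)) ⟩
  sum₁ M (λ j → g (p * j)) + sum₁ M h ≡⟨ sum₁-distrib M (λ j → g (p * j)) h ⟨
  sum₁ M (λ j → g (p * j) + h j)    ≡⟨ sum₁-zero M gh≗0 ⟩
  0ℤ                                ∎

sum₁-indicator : ∀ {p n} → 1 ≤ p → p ≤ n → sum₁ n (λ i → guard (i ≟ p) 1ℤ) ≡ 1ℤ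
sum₁-indicator {suc p} {n} _ 1+p≤n = begin
  sum₁ n δ               ≡⟨ sum₁-extend δ 1+p≤n (λ 1+p<i _ → guard-no (_ ≟ _) (ℕₚ.>⇒≢ 1+p<i)) ⟩
  sum₁ p δ + δ (suc p)   ≡⟨ cong₂ _+_ (sum₁-zero p (λ _ i≤p → guard-no (_ ≟ _) (ℕₚ.<⇒≢ (s≤s i≤p))))
                                      (guard-yes (suc p ≟ suc p) refl) ⟩
  0ℤ + 1ℤ                ∎
  where
  δ : ℕ → ℤ
  δ i = guard (i ≟ suc p) 1ℤ

sumℤ-++ : ∀ xs ys → sumℤ (xs ++ ys) ≡ sumℤ xs + sumℤ ys
sumℤ-++ []       ys = sym (ℤₚ.+-identityˡ (sumℤ ys))
sumℤ-++ (x ∷ xs) ys = trans (cong (_+_ x) (sumℤ-++ xs ys)) (sym (ℤₚ.+-assoc x (sumℤ xs) (sumℤ ys)))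

module _ {p} {P : Pred ℕ p} (P? : Decidable P) (f : ℕ → ℤ) where

  sumℤ-filter-[x] : ∀ x → sumℤ (map f (filter P? [ x ])) ≡ guard (P? x) (f x)
  sumℤ-filter-[x] x with does (P? x)
  ... | true  = ℤₚ.+-identityʳ (f x)
  ... | false = refl

  sumℤ-filter-range1 : ∀ n → sumℤ (map f (filter P? (range1 n))) ≡ sum₁ n (λ i → guard (P? i) (f i))
  sumℤ-filter-range1 zero    = refl
  sumℤ-filter-range1 (suc n) = begin
    sumℤ (map f (filter P? (range1 (suc n))))
      ≡⟨ cong (sumℤ ∘ map f ∘ filter P?) (Listₚ.applyUpTo-∷ʳ suc n) ⟨
    sumℤ (map f (filter P? (range1 n ++ [ suc n ])))
      ≡⟨ cong (sumℤ ∘ map f) (Listₚ.filter-++ P? (range1 n) [ suc n ]) ⟩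
    sumℤ (map f (filter P? (range1 n) ++ filter P? [ suc n ]))
      ≡⟨ cong sumℤ (Listₚ.map-++ f (filter P? (range1 n)) (filter P? [ suc n ])) ⟩
    sumℤ (map f (filter P? (range1 n)) ++ map f (filter P? [ suc n ]))
      ≡⟨ sumℤ-++ (map f (filter P? (range1 n))) (map f (filter P? [ suc n ])) ⟩
    sumℤ (map f (filter P? (range1 n))) + sumℤ (map f (filter P? [ suc n ]))
      ≡⟨ cong₂ _+_ (sumℤ-filter-range1 n) (sumℤ-filter-[x] (suc n)) ⟩
    sum₁ n (λ i → guard (P? i) (f i)) + guard (P? (suc n)) (f (suc n))
      ∎

-- Prime powers and gcd

prime∣prime⇒≡ : ∀ {p q} → Prime p → Prime q → q ∣ p → q ≡ p
prime∣prime⇒≡ p-prime q-prime q∣p with prime⇒irreducible p-prime q∣p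
... | inj₁ refl = ⊥-elim (¬prime[1] q-prime)
... | inj₂ q≡p  = q≡p

prime∤⇒coprime : ∀ {p m} → Prime p → ¬ p ∣ m → Coprime m p
prime∤⇒coprime p-prime p∤m (d∣m , d∣p) with prime⇒irreducible p-prime d∣p
... | inj₁ d≡1 = d≡1
... | inj₂ refl = ⊥-elim (p∤m d∣m)

prime^k∣m*n⇒prime^k∣m : ∀ {p} k {m n} → Prime p → ¬ p ∣ n → p ^ k ∣ m * n → p ^ k ∣ m
prime^k∣m*n⇒prime^k∣m     zero    _       _   _ = 1∣ _
prime^k∣m*n⇒prime^k∣m {p} (suc k) {m} {n} p-prime p∤n p^[1+k]∣mn
  with euclidsLemma m n p-prime (m*n∣⇒m∣ p (p ^ k) p^[1+k]∣mn)
... | inj₂ p∣n = ⊥-elim (p∤n p∣n)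
... | inj₁ (divides-refl c) =
  subst (p ^ suc k ∣_) (ℕₚ.*-comm p c) (*-monoʳ-∣ p (prime^k∣m*n⇒prime^k∣m k p-prime p∤n p^k∣cn))
  where
  instance _ = prime⇒nonZero p-prime
  p^k∣cn : p ^ k ∣ c * n
  p^k∣cn = *-cancelˡ-∣ p (subst (p * p ^ k ∣_) (ℕ*.xy∙z≈y∙xz c p n) p^[1+k]∣mn)

gcd[p*m,n]≡gcd[m,n] : ∀ {p} m n → Prime p → ¬ p ∣ n → gcd (p * m) n ≡ gcd m n
gcd[p*m,n]≡gcd[m,n] {p} m n p-prime p∤n = ∣-antisym
  (gcd-greatest (coprime-divisor g⊥p (gcd[m,n]∣m (p * m) n)) (gcd[m,n]∣n (p * m) n))
  (gcd-greatest (∣-trans (gcd[m,n]∣m m n) (n∣m*n p)) (gcd[m,n]∣n m n))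
  where
  g⊥p : Coprime (gcd (p * m) n) p
  g⊥p = prime∤⇒coprime p-prime (λ p∣g → p∤n (∣-trans p∣g (gcd[m,n]∣n (p * m) n)))

p^a∣m⇒gcd[p*m,n]≡gcd[m,n] : ∀ {p} a {m n} → Prime p → p ^ a ∣ m → ¬ p ^ suc a ∣ n →
                            gcd (p * m) n ≡ gcd m n
p^a∣m⇒gcd[p*m,n]≡gcd[m,n] {p} a {m} {n} p-prime _ _ with p ∣? n
... | no p∤n = gcd[p*m,n]≡gcd[m,n] m n p-prime p∤n
p^a∣m⇒gcd[p*m,n]≡gcd[m,n] {p} zero {n = n} _ _ p∤n | yes p∣n =
  ⊥-elim (p∤n (subst (_∣ n) (sym (ℕₚ.*-identityʳ p)) p∣n))
p^a∣m⇒gcd[p*m,n]≡gcd[m,n] {p} (suc a) p-prime (divides-refl c) p^[2+a]∤n | yes (divides-refl n′) = begin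
  gcd (p * m) (n′ * p)         ≡⟨ cong₂ gcd (cong (p *_) m≡p*m′) (ℕₚ.*-comm n′ p) ⟩
  gcd (p * (p * m′)) (p * n′)  ≡⟨ c*gcd[m,n]≡gcd[cm,cn] p (p * m′) n′ ⟨
  p * gcd (p * m′) n′          ≡⟨ cong (p *_) (p^a∣m⇒gcd[p*m,n]≡gcd[m,n] a p-prime (n∣m*n c) p^[1+a]∤n′) ⟩
  p * gcd m′ n′                ≡⟨ c*gcd[m,n]≡gcd[cm,cn] p m′ n′ ⟩
  gcd (p * m′) (p * n′)        ≡⟨ cong₂ gcd m≡p*m′ (ℕₚ.*-comm n′ p) ⟨
  gcd m (n′ * p)               ∎
  where
  m = c * (p * p ^ a)
  m′ = c * p ^ a
  m≡p*m′ : m ≡ p * m′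
  m≡p*m′ = ℕ*.x∙yz≈y∙xz c p (p ^ a)
  p^[1+a]∤n′ : ¬ p ^ suc a ∣ n′
  p^[1+a]∤n′ p^[1+a]∣n′ = p^[2+a]∤n (subst (p ^ suc (suc a) ∣_) (ℕₚ.*-comm p n′) (*-monoʳ-∣ p p^[1+a]∣n′))

SeparatingPrimePower : ℕ → ℕ → Set
SeparatingPrimePower ℓ n = ∃₂ λ p a → Prime p × p ^ suc a ∣ ℓ × ¬ p ^ suc a ∣ n

product∤⇒separatingPrimePower : ∀ {ps n} → All Prime ps → ¬ product ps ∣ n →
                                SeparatingPrimePower (product ps) n
product∤⇒separatingPrimePower {n = n} [] 1∤n = ⊥-elim (1∤n (1∣ n))
product∤⇒separatingPrimePower {p ∷ ps} {n} (p-prime ∷ ps-prime) p*ps∤n with p ∣? n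
... | no p∤n = p , 0 , p-prime , subst (_∣ p * product ps) (sym (ℕₚ.*-identityʳ p)) (m∣m*n (product ps))
                 , (λ p^1∣n → p∤n (subst (_∣ n) (ℕₚ.*-identityʳ p) p^1∣n))
... | yes (divides-refl c)
  with product∤⇒separatingPrimePower ps-prime
         (λ ps∣c → p*ps∤n (subst (p * product ps ∣_) (ℕₚ.*-comm p c) (*-monoʳ-∣ p ps∣c)))
... | q , a , q-prime , q^[1+a]∣ps , q^[1+a]∤c with q ≟ p
... | yes refl = q , suc a , q-prime , *-monoʳ-∣ q q^[1+a]∣ps
               , (λ q^[2+a]∣cq → q^[1+a]∤c (*-cancelˡ-∣ q {{prime⇒nonZero q-prime}}
                                            (subst (q * q ^ suc a ∣_) (ℕₚ.*-comm c q) q^[2+a]∣cq)))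
... | no q≢p = q , a , q-prime , ∣-trans q^[1+a]∣ps (n∣m*n p)
             , (λ q^[1+a]∣cp → q^[1+a]∤c (prime^k∣m*n⇒prime^k∣m (suc a) q-prime
                                           (λ q∣p → q≢p (prime∣prime⇒≡ p-prime q-prime q∣p)) q^[1+a]∣cp))

∤⇒separatingPrimePower : ∀ {ℓ n} → .{{NonZero ℓ}} → ¬ ℓ ∣ n → SeparatingPrimePower ℓ n
∤⇒separatingPrimePower {ℓ} {n} ℓ∤n =
  subst (λ m → SeparatingPrimePower m n) (sym isFactorisation)
        (product∤⇒separatingPrimePower factorsPrime (subst (λ m → ¬ m ∣ n) isFactorisation ℓ∤n))
  where open PrimeFactorisation (factorise ℓ)

-- The Möbius function

guard-⊎ : ∀ {p q r} {P : Set p} {Q : Set q} {R : Set r} (P? : Dec P) (Q? : Dec Q) (R? : Dec R) →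
          (P → Q ⊎ R) → (Q ⊎ R → P) → (Q → ¬ R) → guard P? 1ℤ ≡ guard Q? 1ℤ + guard R? 1ℤ
guard-⊎ P? (yes q) (yes r) _  _    q⇒¬r = ⊥-elim (q⇒¬r q r)
guard-⊎ P? (yes q) (no _)  _  Q⊎R⇒P _   = guard-yes P? (Q⊎R⇒P (inj₁ q))
guard-⊎ P? (no _)  (yes r) _  Q⊎R⇒P _   = guard-yes P? (Q⊎R⇒P (inj₂ r))
guard-⊎ P? (no ¬q) (no ¬r) P⇒Q⊎R _ _   = guard-no P? (λ p → Sum.[ ¬q , ¬r ] (P⇒Q⊎R p))

length≡sumℤ-ones : ∀ {A : Set} (xs : List A) → + length xs ≡ sumℤ (map (λ _ → 1ℤ) xs)
length≡sumℤ-ones []       = refl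
length≡sumℤ-ones (_ ∷ xs) = cong (_+_ 1ℤ) (length≡sumℤ-ones xs)

isPrimeDivisor? : ∀ x → Decidable (λ q → Prime q × q ∣ x)
isPrimeDivisor? x q = prime? q ×-dec (q ∣? x)

+length-primeDivisors : ∀ x {m} .{{_ : NonZero x}} → x ≤ m →
                        + length (primeDivisors x) ≡ sum₁ m (λ q → guard (isPrimeDivisor? x q) 1ℤ)
+length-primeDivisors x {m} x≤m = begin
  + length (primeDivisors x)                ≡⟨ length≡sumℤ-ones (primeDivisors x) ⟩
  sumℤ (map (λ _ → 1ℤ) (primeDivisors x))  ≡⟨ sumℤ-filter-range1 (isPrimeDivisor? x) (λ _ → 1ℤ) x ⟩
  sum₁ x δ                                  ≡⟨ sum₁-extend δ x≤m (λ x<q _ → guard-no (isPrimeDivisor? x _)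
                                                  (λ (_ , q∣x) → ℕₚ.<⇒≱ x<q (∣⇒≤ q∣x))) ⟨
  sum₁ m δ                                  ∎
  where
  δ : ℕ → ℤ
  δ q = guard (isPrimeDivisor? x q) 1ℤ

primeDivisor[p*x]⇒ : ∀ {p x q} → Prime p → Prime q → q ∣ p * x → q ∣ x ⊎ q ≡ p
primeDivisor[p*x]⇒ {p} {x} p-prime q-prime q∣px with euclidsLemma p x q-prime q∣px
... | inj₁ q∣p = inj₂ (prime∣prime⇒≡ p-prime q-prime q∣p)
... | inj₂ q∣x = inj₁ q∣x

length-primeDivisors-* : ∀ {p x} .{{_ : NonZero x}} → Prime p → ¬ p ∣ x →
                         length (primeDivisors (p * x)) ≡ suc (length (primeDivisors x))
length-primeDivisors-* {p} {x} p-prime p∤x = ℤₚ.+-injective (begin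
  + length (primeDivisors (p * x))            ≡⟨ +length-primeDivisors (p * x) ℕₚ.≤-refl ⟩
  sum₁ (p * x) (δ (p * x))                    ≡⟨ sum₁-cong (p * x) (λ {q} _ _ → split q) ⟩
  sum₁ (p * x) (λ q → δ x q + ι q)            ≡⟨ sum₁-distrib (p * x) (δ x) ι ⟩
  sum₁ (p * x) (δ x) + sum₁ (p * x) ι         ≡⟨ cong₂ _+_ (sym (+length-primeDivisors x (ℕₚ.m≤n*m x p)))
                                                          (sum₁-indicator (ℕ.>-nonZero⁻¹ p) (ℕₚ.m≤m*n p x)) ⟩
  + length (primeDivisors x) + 1ℤ             ≡⟨ ℤₚ.+-comm (+ length (primeDivisors x)) 1ℤ ⟩
  + suc (length (primeDivisors x))            ∎)
  where
  instance
    _ = prime⇒nonZero p-prime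
    _ = ℕₚ.m*n≢0 p x
  δ : ℕ → ℕ → ℤ
  δ y q = guard (isPrimeDivisor? y q) 1ℤ
  ι : ℕ → ℤ
  ι q = guard (q ≟ p) 1ℤ
  split : ∀ q → δ (p * x) q ≡ δ x q + ι q
  split q = guard-⊎ (isPrimeDivisor? (p * x) q) (isPrimeDivisor? x q) (q ≟ p)
    (λ (q-prime , q∣px) → Sum.map₁ (q-prime ,_) (primeDivisor[p*x]⇒ p-prime q-prime q∣px))
    Sum.[ (λ (q-prime , q∣x) → q-prime , ∣n⇒∣m*n p q∣x) , (λ { refl → p-prime , m∣m*n x }) ]
    (λ { (_ , q∣x) refl → p∤x q∣x })

SquareFree : ℕ → Set
SquareFree x = ∀ {q} → Prime q → ¬ q * q ∣ x

∈squareFactors⁺ : ∀ {q x} .{{_ : NonZero x}} → Prime q → q * q ∣ x → q ∈ squareFactors x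
∈squareFactors⁺ {q@(suc _)} {x} q-prime qq∣x =
  ∈-filter⁺ (λ q → q * q ∣? x) (∈-filter⁺ (isPrimeDivisor? x) q∈range1 (q-prime , q∣x)) qq∣x
  where
  q∣x : q ∣ x
  q∣x = m*n∣⇒m∣ q q qq∣x
  q∈range1 : q ∈ range1 x
  q∈range1 = ∈-applyUpTo⁺ suc (∣⇒≤ q∣x)

∈squareFactors⁻ : ∀ {q x} → q ∈ squareFactors x → Prime q × q * q ∣ x
∈squareFactors⁻ {q} {x} q∈sf with ∈-filter⁻ (λ q → q * q ∣? x) q∈sf
... | q∈pd , qq∣x with ∈-filter⁻ (isPrimeDivisor? x) {xs = range1 x} q∈pd
...   | _ , q-prime , _ = q-prime , qq∣x

squareFree⇒squareFactors≡[] : ∀ {x} → SquareFree x → squareFactors x ≡ []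
squareFree⇒squareFactors≡[] {x} sf with squareFactors x in eq
... | []    = refl
... | q ∷ _ with ∈squareFactors⁻ (subst (q ∈_) (sym eq) (here refl))
...   | q-prime , qq∣x = ⊥-elim (sf q-prime qq∣x)

squareFree-* : ∀ {p x} → Prime p → ¬ p ∣ x → SquareFree x → SquareFree (p * x)
squareFree-* {p} {x} p-prime p∤x sf {q} q-prime qq∣px with q ≟ p
... | yes refl = p∤x (*-cancelˡ-∣ q {{prime⇒nonZero q-prime}} qq∣px)
... | no q≢p   = sf q-prime (subst (_∣ x) q^2≡q*q q^2∣x)
  where
  q^2≡q*q : q ^ 2 ≡ q * q
  q^2≡q*q = cong (q *_) (ℕₚ.*-identityʳ q)
  q^2∣x : q ^ 2 ∣ x
  q^2∣x = prime^k∣m*n⇒prime^k∣m 2 q-prime (λ q∣p → q≢p (prime∣prime⇒≡ p-prime q-prime q∣p))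
            (subst₂ _∣_ (sym q^2≡q*q) (ℕₚ.*-comm p x) qq∣px)

μ-square : ∀ {q x} .{{_ : NonZero x}} → Prime q → q * q ∣ x → μ x ≡ 0ℤ
μ-square {x = x} q-prime qq∣x with squareFactors x | ∈squareFactors⁺ q-prime qq∣x
... | _ ∷ _ | _ = refl

μ-squareFree : ∀ {x} → SquareFree x → μ x ≡ -1ℤ ℤ.^ length (primeDivisors x)
μ-squareFree {x} sf rewrite squareFree⇒squareFactors≡[] sf = refl

μ-p*x≡-μ[x] : ∀ {p x} .{{_ : NonZero x}} → Prime p → ¬ p ∣ x → μ (p * x) ≡ - μ x
μ-p*x≡-μ[x] {p} {x} p-prime p∤x with squareFactors x in eq
... | q ∷ _ with ∈squareFactors⁻ (subst (q ∈_) (sym eq) (here refl))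
...   | q-prime , qq∣x = μ-square {{ℕₚ.m*n≢0 p x {{prime⇒nonZero p-prime}}}} q-prime (∣n⇒∣m*n p qq∣x)
μ-p*x≡-μ[x] {p} {x} p-prime p∤x | [] = begin
  μ (p * x)                                    ≡⟨ μ-squareFree (squareFree-* p-prime p∤x sf) ⟩
  -1ℤ ℤ.^ length (primeDivisors (p * x))       ≡⟨ cong (-1ℤ ℤ.^_) (length-primeDivisors-* p-prime p∤x) ⟩
  -1ℤ ℤ.* -1ℤ ℤ.^ length (primeDivisors x)     ≡⟨ ℤₚ.-1*i≡-i _ ⟩
  - (-1ℤ ℤ.^ length (primeDivisors x))         ∎
  where
  sf : SquareFree x
  sf q-prime qq∣x with () ← subst (_ ∈_) eq (∈squareFactors⁺ q-prime qq∣x)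

-- Pairing the divisors p j and j

cofactor-terms-cancel : ∀ {p e a b} .{{_ : NonZero e}} {P : Set a} {Q : Set b} (P? : Dec P) (Q? : Dec Q) →
                        Prime p → (¬ p ∣ e → P → Q) → (¬ p ∣ e → Q → P) →
                        guard (¬? (p ∣? e)) (guard P? (μ e)) + guard (p ∣? p * e) (guard Q? (μ (p * e))) ≡ 0ℤ
cofactor-terms-cancel {p} {e} P? Q? p-prime P⇒Q Q⇒P with p ∣? e
... | yes p∣e = begin
  0ℤ + guard (p ∣? p * e) (guard Q? (μ (p * e)))
    ≡⟨ cong (λ z → 0ℤ + guard (p ∣? p * e) (guard Q? z))
            (μ-square {{ℕₚ.m*n≢0 p e {{prime⇒nonZero p-prime}}}} p-prime (*-monoʳ-∣ p p∣e)) ⟩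
  0ℤ + guard (p ∣? p * e) (guard Q? 0ℤ)
    ≡⟨ cong (λ z → 0ℤ + guard (p ∣? p * e) z) (guard-0 Q?) ⟩
  0ℤ + guard (p ∣? p * e) 0ℤ
    ≡⟨ cong (_+_ 0ℤ) (guard-0 (p ∣? p * e)) ⟩
  0ℤ ∎
... | no p∤e = begin
  guard P? (μ e) + guard (p ∣? p * e) (guard Q? (μ (p * e)))
    ≡⟨ cong (_+_ (guard P? (μ e))) (guard-yes (p ∣? p * e) (m∣m*n e)) ⟩
  guard P? (μ e) + guard Q? (μ (p * e))
    ≡⟨ cong (λ z → guard P? (μ e) + guard Q? z) (μ-p*x≡-μ[x] p-prime p∤e) ⟩
  guard P? (μ e) + guard Q? (- μ e)
    ≡⟨ guard-cancel P? Q? (μ e) (P⇒Q p∤e) (Q⇒P p∤e) ⟩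
  0ℤ ∎

÷-exact : ∀ {m n d} .{{_ : NonZero n}} → m ≡ d * n → m ÷ n ≡ d
÷-exact {n = suc _} {d} refl = m*n/n≡m d _

m÷n*n≡m : ∀ {m n} .{{_ : NonZero n}} → n ∣ m → m ÷ n * n ≡ m
m÷n*n≡m {n = suc _} = m/n*n≡m

p∣[p*M÷k]⇒k∣M : ∀ {p M k} .{{_ : NonZero p}} .{{_ : NonZero k}} → k ∣ p * M → p ∣ (p * M) ÷ k → k ∣ M
p∣[p*M÷k]⇒k∣M {p} {M} {k} (divides d pM≡dk) p∣pM÷k with subst (p ∣_) (÷-exact {p * M} {k} {d} pM≡dk) p∣pM÷k
... | divides-refl c = divides c (ℕₚ.*-cancelˡ-≡ M (c * k) p (trans pM≡dk (ℕ*.xy∙z≈y∙xz c p k)))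

module _ {p a M} (n t : ℕ) (p-prime : Prime p) .{{_ : NonZero M}} (p^a∣M : p ^ a ∣ M)
         (p^[1+a]∤n : ¬ p ^ suc a ∣ n) where

  private
    instance _ = prime⇒nonZero p-prime

    ℓ : ℕ
    ℓ = p * M

    admissible? : ∀ k → Dec (k ∣ ℓ × gcd k n ≡ t)
    admissible? k = (k ∣? ℓ) ×-dec (gcd k n ≟ t)

    term term∤ term∣ : ℕ → ℤ
    term  k = guard (admissible? k) (μ (ℓ ÷ k))
    term∤ k = guard (¬? (p ∣? ℓ ÷ k)) (term k)
    term∣ k = guard (p ∣? ℓ ÷ k) (term k)

    term∤-vanishes : ∀ {k} → ¬ p ∣ k → term∤ k ≡ 0ℤ
    term∤-vanishes {zero}    p∤0 = ⊥-elim (p∤0 (p ∣0))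
    term∤-vanishes {k@(suc _)} p∤k = guard²-no (¬? (p ∣? ℓ ÷ k)) (admissible? k) λ p∤ℓ÷k (k∣ℓ , _) →
      Sum.[ p∤ℓ÷k , p∤k ] (euclidsLemma (ℓ ÷ k) k p-prime
        (subst (p ∣_) (sym (m÷n*n≡m k∣ℓ)) (m∣m*n M)))

    term∣-vanishes : ∀ {k} → M < k → term∣ k ≡ 0ℤ
    term∣-vanishes {k} M<k = guard²-no (p ∣? ℓ ÷ k) (admissible? k) λ p∣ℓ÷k (k∣ℓ , _) →
      ℕₚ.<⇒≱ M<k (∣⇒≤ (p∣[p*M÷k]⇒k∣M k∣ℓ p∣ℓ÷k))
      where instance _ = ℕ.>-nonZero (ℕₚ.≤-<-trans ℕ.z≤n M<k)

    pair-∤ : ∀ {j} .{{_ : NonZero j}} → ¬ j ∣ M → term∤ (p * j) + term∣ j ≡ 0ℤ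
    pair-∤ {j} j∤M = cong₂ _+_
      (guard²-no (¬? (p ∣? ℓ ÷ (p * j))) (admissible? (p * j)) λ _ (pj∣ℓ , _) → j∤M (*-cancelˡ-∣ p pj∣ℓ))
      (guard²-no (p ∣? ℓ ÷ j) (admissible? j) λ p∣ℓ÷j (j∣ℓ , _) → j∤M (p∣[p*M÷k]⇒k∣M j∣ℓ p∣ℓ÷j))

    pair-∣ : ∀ {j e} .{{_ : NonZero j}} → M ≡ e * j → term∤ (p * j) + term∣ j ≡ 0ℤ
    pair-∣ {j} {e} M≡ej = begin
      term∤ (p * j) + term∣ j
        ≡⟨ cong₂ _+_ (cong (λ d → guard (¬? (p ∣? d)) (guard (admissible? (p * j)) (μ d))) (÷-exact ℓ≡e*pj))
                     (cong (λ d → guard (p ∣? d) (guard (admissible? j) (μ d))) (÷-exact ℓ≡pe*j)) ⟩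
      guard (¬? (p ∣? e)) (guard (admissible? (p * j)) (μ e))
        + guard (p ∣? p * e) (guard (admissible? j) (μ (p * e)))
        ≡⟨ cofactor-terms-cancel (admissible? (p * j)) (admissible? j) p-prime
             (λ p∤e (_ , gcd≡t) → j∣ℓ , trans (sym (gcd[pj,n]≡gcd[j,n] p∤e)) gcd≡t)
             (λ p∤e (_ , gcd≡t) → pj∣ℓ , trans (gcd[pj,n]≡gcd[j,n] p∤e) gcd≡t) ⟩
      0ℤ ∎
      where
      instance
        _ = ℕₚ.m*n≢0 p j
        _ = ℕₚ.m*n≢0⇒m≢0 e {{ℕ.>-nonZero (subst (0 <_) M≡ej (ℕ.>-nonZero⁻¹ M))}}

      ℓ≡e*pj : ℓ ≡ e * (p * j)
      ℓ≡e*pj = trans (cong (p *_) M≡ej) (ℕ*.x∙yz≈y∙xz p e j)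

      ℓ≡pe*j : ℓ ≡ p * e * j
      ℓ≡pe*j = trans (cong (p *_) M≡ej) (sym (ℕₚ.*-assoc p e j))

      pj∣ℓ : p * j ∣ ℓ
      pj∣ℓ = divides e ℓ≡e*pj

      j∣ℓ : j ∣ ℓ
      j∣ℓ = divides (p * e) ℓ≡pe*j

      gcd[pj,n]≡gcd[j,n] : ¬ p ∣ e → gcd (p * j) n ≡ gcd j n
      gcd[pj,n]≡gcd[j,n] p∤e = p^a∣m⇒gcd[p*m,n]≡gcd[m,n] a p-prime p^a∣j p^[1+a]∤n
        where
        p^a∣j : p ^ a ∣ j
        p^a∣j = prime^k∣m*n⇒prime^k∣m a p-prime p∤e (subst (p ^ a ∣_) (trans M≡ej (ℕₚ.*-comm e j)) p^a∣M)

    pair : ∀ {j} → 1 ≤ j → term∤ (p * j) + term∣ j ≡ 0ℤ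
    pair {j} 1≤j with j ∣? M
    ... | no  j∤M               = pair-∤ {{ℕ.>-nonZero 1≤j}} j∤M
    ... | yes (divides e M≡ej) = pair-∣ {j} {e} {{ℕ.>-nonZero 1≤j}} M≡ej

  mobiusGcdSum[p*M]≡0 : mobiusGcdSum (p * M) n t ≡ 0ℤ
  mobiusGcdSum[p*M]≡0 = begin
    mobiusGcdSum ℓ n t
      ≡⟨ sumℤ-filter-range1 admissible? (λ k → μ (ℓ ÷ k)) ℓ ⟩
    sum₁ ℓ term
      ≡⟨ sum₁-cong ℓ (λ {k} _ _ → guard-split (p ∣? ℓ ÷ k) (term k)) ⟩
    sum₁ ℓ (λ k → term∤ k + term∣ k)
      ≡⟨ sum₁-pairing p M term∤-vanishes term∣-vanishes (λ 1≤j _ → pair 1≤j) ⟩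
    0ℤ ∎

lemma2p4 : (ℓ n : ℕ) → 1 ≤ ℓ → 1 ≤ n → ¬ (ℓ ∣ n) → (t : ℕ) → 1 ≤ t → t ∣ n → mobiusGcdSum ℓ n t ≡ + 0
lemma2p4 ℓ n 1≤ℓ _ ℓ∤n t _ _
  with p , a , p-prime , divides c ℓ≡c*p^[1+a] , p^[1+a]∤n
         ← ∤⇒separatingPrimePower {{ℕ.>-nonZero 1≤ℓ}} ℓ∤n
  = subst (λ ℓ → mobiusGcdSum ℓ n t ≡ 0ℤ) (sym ℓ≡p*M)
      (mobiusGcdSum[p*M]≡0 {a = a} n t p-prime {{M≢0}} (n∣m*n c) p^[1+a]∤n)
  where
  ℓ≡p*M : ℓ ≡ p * (c * p ^ a)
  ℓ≡p*M = trans ℓ≡c*p^[1+a] (ℕ*.x∙yz≈y∙xz c p (p ^ a))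
  M≢0 : NonZero (c * p ^ a)
  M≢0 = ℕₚ.m*n≢0⇒n≢0 p {{ℕ.>-nonZero (subst (1 ≤_) ℓ≡p*M 1≤ℓ)}}
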